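{- Let $n\geq3$. Then (i) $|G_n| = 2^n-1 - n\cdot2^{\lfloor n/2\rfloor} + \frac n2$ if $n$ is even, and $|G_n| = 2^n-1 - n\cdot2^{\lfloor n/2\rfloor}$ if $n$ is odd; (ii) for any $3\leq m\leq n$, $|G_{m,n}| = \binom nm - n\binom{\lfloor n/2\rfloor}{m-1}$.
   Context: For $n\geq3$, let $T_n$ be the set of $n$-tuples $(a_1,\dots,a_n)$ with entries in $\{0,1\}$, with positions regarded cyclically (modulo $n$). A block of 0's of length $l$ in such a tuple is a sequence of $l$ cyclically consecutive positions (possibly wrapping around from $n$ to $1$) all of whose entries are $0$, not contained in a longer such sequence. Write $k=\lfloor n/2\rfloor$. A block of 0's is bad if its length is at least $k-1$ (when $n=2k$ is even) or at least $k$ (when $n=2k+1$ is odd); a tuple is bad if it has a bad block (the all-zero tuple is bad) and good otherwise. $G_n$ is the set of good tuples in $T_n$ and $G_{m,n}$ the set of good tuples with exactly $m$ entries equal to $1$. Binomial coefficients $\binom ab$ are $0$ unless $a,b$ are non-negative integers with $b\le a$. -}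

module Defs where

open import Data.Bool using (Bool; true; false; if_then_else_)
open import Data.Nat using (ℕ; zero; suc; _+_; _*_; _∸_; _≤_; _<_; _≡ᵇ_)
open import Data.Nat.DivMod using (_/_; _%_; _mod_)
open import Data.Vec using (Vec; []; _∷_; lookup; replicate)
open import Data.List using (List; length)
open import Data.List.Membership.Propositional using (_∈_)
open import Data.List.Relation.Unary.Unique.Propositional using (Unique)
open import Data.Product using (Σ; ∃; _×_)
open import Data.Sum using (_⊎_)
open import Relation.Nullary using (¬_)
open import Relation.Binary.PropositionalEquality using (_≡_)
open import Function.Bundles using (_⇔_)

-- T_n : n-tuples of 0/1, encoded as Vec Bool n (false = 0, true = 1)
T : ℕ → Set
T n = Vec Bool n

at : ∀ {n} → Vec Bool n → ℕ → Bool
at {zero}  v i = false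
at {suc n} v i = lookup v (i mod suc n)

half : ℕ → ℕ
half n = n / 2

badThreshold : ℕ → ℕ
badThreshold n = if n % 2 ≡ᵇ 0 then half n ∸ 1 else half n

-- a block of 0's of length l starting at (0-based) position i:
-- l cyclically consecutive 0's, not contained in a longer such sequence
-- (so l < n and the cyclic neighbours i-1 and i+l carry a 1)
record Block {n : ℕ} (v : Vec Bool n) (i l : ℕ) : Set where
  field
    start<n  : i < n
    1≤l      : 1 ≤ l
    l<n      : l < n
    zeros    : ∀ j → j < l → at v (i + j) ≡ false
    rightEnd : at v (i + l) ≡ true
    leftEnd  : at v (i + (n ∸ 1)) ≡ true

BadBlock : ∀ {n} → Vec Bool n → ℕ → ℕ → Set
BadBlock {n} v i l = Block v i l × badThreshold n ≤ l

Bad : ∀ {n} → Vec Bool n → Set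
Bad {n} v = (v ≡ replicate n false) ⊎ ∃ λ i → ∃ λ l → BadBlock v i l

Good : ∀ {n} → Vec Bool n → Set
Good v = ¬ Bad v

ones : ∀ {n} → Vec Bool n → ℕ
ones []          = 0
ones (true ∷ v)  = suc (ones v)
ones (false ∷ v) = ones v

GoodWith : ∀ {n} → ℕ → Vec Bool n → Set
GoodWith m v = Good v × ones v ≡ m

HasCard : {A : Set} → (A → Set) → ℕ → Set
HasCard {A} P N = Σ (List A) λ xs → Unique xs × (∀ x → (x ∈ xs) ⇔ P x) × length xs ≡ N

module Submission where

-- Write n = th + 1 + k with th = badThreshold n and k = ⌊n/2⌋, so k = th for
-- odd n and k = th + 1 for even n.  A non-zero tuple is bad iff some cyclic
-- position p carries a 1 followed by th 0's (a "run at p").  For a predicate Q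
-- invariant under rotation, the run events at the n positions each contain
-- #{w ∈ {0,1}ᵏ | Q (1 0^th w)} tuples of Q, and their union is counted by adding
-- the events one at a time and subtracting the overlaps with earlier ones.
-- Two runs are more than th apart in both cyclic directions: for odd n they
-- never coexist, and for even n the only overlaps come from the k rotations of
-- 1 0^th 1 0^th, a tuple with two ones.  Taking Q = "all tuples" gives (i) and
-- Q = "exactly m ones" gives (ii).

open import Defs
open import Algebra.Properties.CommutativeSemigroup using (interchange)
open import Data.Bool using (Bool; true; false; if_then_else_; _∧_; _∨_; not)
open import Data.Bool.Properties using (∧-assoc; ∧-comm; ∧-identityʳ; ∨-zeroʳ; ¬-not; T-≡)
open import Data.Empty using (⊥; ⊥-elim)
open import Data.Fin using (Fin; toℕ; fromℕ<) renaming (zero to fzero; suc to fsuc)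
open import Data.Fin.Properties using (toℕ-fromℕ<)
open import Data.List using (List; []; _∷_; length; map) renaming (_++_ to _++ₗ_)
open import Data.List.Membership.Propositional using (_∈_)
open import Data.List.Membership.Propositional.Properties using (∈-map⁺; ∈-map⁻; ∈-++⁺ˡ; ∈-++⁺ʳ; ∈-++⁻)
open import Data.List.Properties using (length-++; length-map)
open import Data.List.Relation.Unary.Any using (here)
open import Data.List.Relation.Unary.Unique.Propositional using (Unique)
open import Data.List.Relation.Unary.Unique.Propositional.Properties using (map⁺; ++⁺)
import Data.List.Relation.Unary.All as All
import Data.List.Relation.Unary.AllPairs as AllPairs
open import Data.Nat using (ℕ; zero; suc; _+_; _*_; _^_; _≤_; _<_; _∸_; _≡ᵇ_; z≤n; s≤s; _<?_)
open import Data.Nat.Combinatorics using (_C_; nCk+nC[k+1]≡[n+1]C[k+1])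
open import Data.Nat.Divisibility using (n∣m*n)
open import Data.Nat.DivMod
  using (_/_; _%_; m≡m%n+[m/n]*n; m%n<n; m%n%n≡m%n; [m+n]%n≡m%n; [m+kn]%n≡m%n; %-distribˡ-+;
         m<n⇒m%n≡m; n%n≡0; m*n/n≡m; m*n%n≡0; +-distrib-/-∣ʳ)
open import Data.Nat.Properties
open import Data.Product using (∃; _×_; _,_; proj₁; proj₂)
open import Data.Sum using (_⊎_; inj₁; inj₂)
open import Data.Vec using (Vec; []; _∷_; _∷ʳ_; replicate; _++_; lookup)
open import Data.Vec.Properties using (∷-injectiveʳ)
open import Function using (_∘_)
open import Function.Bundles using (_⇔_; mk⇔; module Equivalence)
open import Relation.Nullary using (¬_; yes; no)
open import Relation.Binary.PropositionalEquality

open ≡-Reasoning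

+-interchange : ∀ a b c d → (a + b) + (c + d) ≡ (a + c) + (b + d)
+-interchange = interchange +-commutativeSemigroup

count : (n : ℕ) → (Vec Bool n → Bool) → ℕ
count zero    P = if P [] then 1 else 0
count (suc n) P = count n (λ v → P (true ∷ v)) + count n (λ v → P (false ∷ v))

count-ext : ∀ n {P Q : Vec Bool n → Bool} → (∀ v → P v ≡ Q v) → count n P ≡ count n Q
count-ext zero    P≗Q rewrite P≗Q [] = refl
count-ext (suc n) P≗Q = cong₂ _+_ (count-ext n (λ v → P≗Q (true ∷ v))) (count-ext n (λ v → P≗Q (false ∷ v)))

count-none : ∀ n {P : Vec Bool n → Bool} → (∀ v → P v ≡ false) → count n P ≡ 0
count-none zero    P≡false rewrite P≡false [] = refl
count-none (suc n) P≡false =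
  cong₂ _+_ (count-none n (λ v → P≡false (true ∷ v))) (count-none n (λ v → P≡false (false ∷ v)))

count-all : ∀ n → count n (λ _ → true) ≡ 2 ^ n
count-all zero    = refl
count-all (suc n) rewrite count-all n = cong (2 ^ n +_) (sym (+-identityʳ (2 ^ n)))

count-∨∧ : ∀ n (P R Q : Vec Bool n → Bool) →
  count n (λ v → (P v ∨ R v) ∧ Q v) + count n (λ v → (P v ∧ R v) ∧ Q v)
    ≡ count n (λ v → P v ∧ Q v) + count n (λ v → R v ∧ Q v)
count-∨∧ zero P R Q with P []
... | true  = refl
... | false = +-identityʳ _
count-∨∧ (suc n) P R Q = begin
  (a₁ + a₀) + (b₁ + b₀) ≡⟨ +-interchange a₁ a₀ b₁ b₀ ⟩
  (a₁ + b₁) + (a₀ + b₀) ≡⟨ cong₂ _+_ (count-∨∧ n (λ v → P (true ∷ v)) (λ v → R (true ∷ v)) (λ v → Q (true ∷ v)))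
                                     (count-∨∧ n (λ v → P (false ∷ v)) (λ v → R (false ∷ v)) (λ v → Q (false ∷ v))) ⟩
  (c₁ + d₁) + (c₀ + d₀) ≡⟨ +-interchange c₁ d₁ c₀ d₀ ⟩
  (c₁ + c₀) + (d₁ + d₀) ∎
  where
  a₁ = count n (λ v → (P (true ∷ v) ∨ R (true ∷ v)) ∧ Q (true ∷ v))
  a₀ = count n (λ v → (P (false ∷ v) ∨ R (false ∷ v)) ∧ Q (false ∷ v))
  b₁ = count n (λ v → (P (true ∷ v) ∧ R (true ∷ v)) ∧ Q (true ∷ v))
  b₀ = count n (λ v → (P (false ∷ v) ∧ R (false ∷ v)) ∧ Q (false ∷ v))
  c₁ = count n (λ v → P (true ∷ v) ∧ Q (true ∷ v))
  c₀ = count n (λ v → P (false ∷ v) ∧ Q (false ∷ v))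
  d₁ = count n (λ v → R (true ∷ v) ∧ Q (true ∷ v))
  d₀ = count n (λ v → R (false ∷ v) ∧ Q (false ∷ v))

count-complement : ∀ n (P Q : Vec Bool n → Bool) →
  count n (λ v → not (P v) ∧ Q v) + count n (λ v → P v ∧ Q v) ≡ count n Q
count-complement zero P Q with P []
... | true  = refl
... | false = +-identityʳ _
count-complement (suc n) P Q = begin
  (a₁ + a₀) + (b₁ + b₀) ≡⟨ +-interchange a₁ a₀ b₁ b₀ ⟩
  (a₁ + b₁) + (a₀ + b₀) ≡⟨ cong₂ _+_ (count-complement n _ _) (count-complement n _ _) ⟩
  count (suc n) Q       ∎
  where
  a₁ = count n (λ v → not (P (true ∷ v)) ∧ Q (true ∷ v))
  a₀ = count n (λ v → not (P (false ∷ v)) ∧ Q (false ∷ v))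
  b₁ = count n (λ v → P (true ∷ v) ∧ Q (true ∷ v))
  b₀ = count n (λ v → P (false ∷ v) ∧ Q (false ∷ v))

hasOnes : ∀ {n} → ℕ → Vec Bool n → Bool
hasOnes m v = ones v ≡ᵇ m

hasOnes⇒ : ∀ {n} m (v : Vec Bool n) → hasOnes m v ≡ true → ones v ≡ m
hasOnes⇒ m v h = ≡ᵇ⇒≡ (ones v) m (Equivalence.from T-≡ h)

hasOnes⇐ : ∀ {n} m (v : Vec Bool n) → ones v ≡ m → hasOnes m v ≡ true
hasOnes⇐ m v refl = Equivalence.to T-≡ (≡⇒≡ᵇ m m refl)

count-hasOnes : ∀ n m → count n (hasOnes m) ≡ n C m
count-hasOnes zero    zero    = refl
count-hasOnes zero    (suc m) = refl
count-hasOnes (suc n) zero    = cong₂ _+_ (count-none n (λ _ → refl)) (count-hasOnes n zero)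
count-hasOnes (suc n) (suc m) =
  trans (cong₂ _+_ (count-hasOnes n m) (count-hasOnes n (suc m))) (nCk+nC[k+1]≡[n+1]C[k+1] n m)

enumerate : (n : ℕ) → (Vec Bool n → Bool) → List (Vec Bool n)
enumerate zero    P = if P [] then [] ∷ [] else []
enumerate (suc n) P =
  map (true ∷_) (enumerate n (λ v → P (true ∷ v))) ++ₗ map (false ∷_) (enumerate n (λ v → P (false ∷ v)))

enumerate-length : ∀ n P → length (enumerate n P) ≡ count n P
enumerate-length zero P with P []
... | true  = refl
... | false = refl
enumerate-length (suc n) P = begin
  length (map (true ∷_) xs ++ₗ map (false ∷_) ys) ≡⟨ length-++ (map (true ∷_) xs) ⟩
  length (map (true ∷_) xs) + length (map (false ∷_) ys)
    ≡⟨ cong₂ _+_ (length-map (true ∷_) xs) (length-map (false ∷_) ys) ⟩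
  length xs + length ys
    ≡⟨ cong₂ _+_ (enumerate-length n (λ v → P (true ∷ v))) (enumerate-length n (λ v → P (false ∷ v))) ⟩
  count (suc n) P ∎
  where
  xs = enumerate n (λ v → P (true ∷ v))
  ys = enumerate n (λ v → P (false ∷ v))

enumerate-sound : ∀ n P v → v ∈ enumerate n P → P v ≡ true
enumerate-sound zero P [] v∈ with P []
enumerate-sound zero P [] v∈ | true = refl
enumerate-sound zero P [] () | false
enumerate-sound (suc n) P v v∈ with ∈-++⁻ (map (true ∷_) (enumerate n (λ v → P (true ∷ v)))) v∈
... | inj₁ v∈₁ with ∈-map⁻ (true ∷_) v∈₁
...   | w , w∈ , refl = enumerate-sound n _ w w∈
enumerate-sound (suc n) P v v∈ | inj₂ v∈₀ with ∈-map⁻ (false ∷_) v∈₀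
...   | w , w∈ , refl = enumerate-sound n _ w w∈

enumerate-complete : ∀ n P v → P v ≡ true → v ∈ enumerate n P
enumerate-complete zero P [] Pv rewrite Pv = here refl
enumerate-complete (suc n) P (true ∷ v) Pv =
  ∈-++⁺ˡ (∈-map⁺ (true ∷_) (enumerate-complete n _ v Pv))
enumerate-complete (suc n) P (false ∷ v) Pv =
  ∈-++⁺ʳ (map (true ∷_) (enumerate n (λ v → P (true ∷ v)))) (∈-map⁺ (false ∷_) (enumerate-complete n _ v Pv))

enumerate-unique : ∀ n P → Unique (enumerate n P)
enumerate-unique zero P with P []
... | true  = All.[] AllPairs.∷ AllPairs.[]
... | false = AllPairs.[]
enumerate-unique (suc n) P =
  ++⁺ (map⁺ ∷-injectiveʳ (enumerate-unique n _)) (map⁺ ∷-injectiveʳ (enumerate-unique n _)) heads-differ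
  where
  heads-differ : ∀ {v} → ¬ (v ∈ map (true ∷_) (enumerate n (λ v → P (true ∷ v)))
                           × v ∈ map (false ∷_) (enumerate n (λ v → P (false ∷ v))))
  heads-differ (v∈₁ , v∈₀) with ∈-map⁻ (true ∷_) v∈₁ | ∈-map⁻ (false ∷_) v∈₀
  ... | _ , _ , refl | _ , _ , ()

hasCard-count : ∀ n (P : Vec Bool n → Bool) (S : Vec Bool n → Set) →
  (∀ v → S v ⇔ (P v ≡ true)) → HasCard S (count n P)
hasCard-count n P S S⇔P =
  enumerate n P , enumerate-unique n P ,
  (λ v → mk⇔ (λ v∈ → Equivalence.from (S⇔P v) (enumerate-sound n P v v∈))
             (λ Sv → enumerate-complete n P v (Equivalence.to (S⇔P v) Sv))) ,
  enumerate-length n P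

rot : ∀ {n} → Vec Bool n → Vec Bool n
rot []      = []
rot (x ∷ v) = v ∷ʳ x

rotN : ∀ {n} → ℕ → Vec Bool n → Vec Bool n
rotN zero    v = v
rotN (suc p) v = rotN p (rot v)

rotN-+ : ∀ {n} a b (v : Vec Bool n) → rotN b (rotN a v) ≡ rotN (a + b) v
rotN-+ zero    b v = refl
rotN-+ (suc a) b v = rotN-+ a b (rot v)

count-∷ʳ : ∀ n (P : Vec Bool (suc n) → Bool) →
  count (suc n) P ≡ count n (λ v → P (v ∷ʳ true)) + count n (λ v → P (v ∷ʳ false))
count-∷ʳ zero    P = refl
count-∷ʳ (suc n) P = begin
  count (suc (suc n)) P
    ≡⟨ cong₂ _+_ (count-∷ʳ n (λ v → P (true ∷ v))) (count-∷ʳ n (λ v → P (false ∷ v))) ⟩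
  (count n (λ v → P (true ∷ (v ∷ʳ true))) + count n (λ v → P (true ∷ (v ∷ʳ false))))
    + (count n (λ v → P (false ∷ (v ∷ʳ true))) + count n (λ v → P (false ∷ (v ∷ʳ false))))
    ≡⟨ +-interchange (count n (λ v → P (true ∷ (v ∷ʳ true)))) _ _ _ ⟩
  count (suc n) (λ v → P (v ∷ʳ true)) + count (suc n) (λ v → P (v ∷ʳ false)) ∎

-- Rotation is a bijection of {0,1}ⁿ, so it does not change counts.
count-rot : ∀ n (P : Vec Bool n → Bool) → count n (P ∘ rot) ≡ count n P
count-rot zero    P = refl
count-rot (suc n) P = sym (count-∷ʳ n P)

count-rotN : ∀ n p (P : Vec Bool n → Bool) → count n (P ∘ rotN p) ≡ count n P
count-rotN n zero    P = refl
count-rotN n (suc p) P = trans (count-rot n (P ∘ rotN p)) (count-rotN n p P)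

ones-∷ʳ : ∀ {n} x (v : Vec Bool n) → ones (v ∷ʳ x) ≡ ones (x ∷ v)
ones-∷ʳ true  []          = refl
ones-∷ʳ true  (true ∷ v)  = cong suc (ones-∷ʳ true v)
ones-∷ʳ true  (false ∷ v) = ones-∷ʳ true v
ones-∷ʳ false []          = refl
ones-∷ʳ false (true ∷ v)  = cong suc (ones-∷ʳ false v)
ones-∷ʳ false (false ∷ v) = ones-∷ʳ false v

ones-rotN : ∀ {n} p (v : Vec Bool n) → ones (rotN p v) ≡ ones v
ones-rotN zero    v       = refl
ones-rotN (suc p) []      = ones-rotN p []
ones-rotN (suc p) (x ∷ v) = trans (ones-rotN p (v ∷ʳ x)) (ones-∷ʳ x v)

get : ∀ {n} → Vec Bool n → ℕ → Bool
get []      _       = false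
get (x ∷ v) zero    = x
get (x ∷ v) (suc i) = get v i

lookup-get : ∀ {n} (v : Vec Bool n) (f : Fin n) → lookup v f ≡ get v (toℕ f)
lookup-get (x ∷ v) fzero    = refl
lookup-get (x ∷ v) (fsuc f) = lookup-get v f

at-get : ∀ {n} (v : Vec Bool (suc n)) i → at v i ≡ get v (i % suc n)
at-get {n} v i = trans (lookup-get v (fromℕ< (m%n<n i (suc n)))) (cong (get v) (toℕ-fromℕ< (m%n<n i (suc n))))

at-≡mod : ∀ {n} (v : Vec Bool (suc n)) i j → i % suc n ≡ j % suc n → at v i ≡ at v j
at-≡mod v i j i≡j = trans (at-get v i) (trans (cong (get v) i≡j) (sym (at-get v j)))

at-+n : ∀ {n} (v : Vec Bool (suc n)) i → at v (i + suc n) ≡ at v i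
at-+n {n} v i = at-≡mod v (i + suc n) i ([m+n]%n≡m%n i (suc n))

at-% : ∀ {n} (v : Vec Bool (suc n)) a b → at v (a % suc n + b) ≡ at v (a + b)
at-% {n} v a b = at-≡mod v (a % suc n + b) (a + b) (begin
  (a % N + b) % N             ≡⟨ %-distribˡ-+ (a % N) b N ⟩
  (a % N % N + b % N) % N     ≡⟨ cong (λ z → (z + b % N) % N) (m%n%n≡m%n a N) ⟩
  (a % N + b % N) % N         ≡⟨ %-distribˡ-+ a b N ⟨
  (a + b) % N                 ∎)
  where N = suc n

at-< : ∀ {n} (v : Vec Bool (suc n)) {i} → i < suc n → at v i ≡ get v i
at-< {n} v {i} i<n = trans (at-get v i) (cong (get v) (m<n⇒m%n≡m i<n))

at-rot : ∀ {n} (v : Vec Bool (suc n)) i → at (rot v) i ≡ at v (suc i)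
at-rot {n} (x ∷ v) i = begin
  at (v ∷ʳ x) i                  ≡⟨ at-get (v ∷ʳ x) i ⟩
  get (v ∷ʳ x) (i % suc n)       ≡⟨ get-rot (i % suc n) (m%n<n i (suc n)) ⟩
  at (x ∷ v) (suc (i % suc n))   ≡⟨ at-≡mod (x ∷ v) (suc (i % suc n)) (suc i) suc-% ⟩
  at (x ∷ v) (suc i)             ∎
  where
  suc-% : suc (i % suc n) % suc n ≡ suc i % suc n
  suc-% = begin
    suc (i % suc n) % suc n                         ≡⟨ [m+kn]%n≡m%n (suc (i % suc n)) (i / suc n) (suc n) ⟨
    (suc (i % suc n) + (i / suc n) * suc n) % suc n ≡⟨ cong (λ z → suc z % suc n) (m≡m%n+[m/n]*n i (suc n)) ⟨
    suc i % suc n                                   ∎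
  get-∷ʳ-< : ∀ {m} (u : Vec Bool m) r → r < m → get (u ∷ʳ x) r ≡ get u r
  get-∷ʳ-< (y ∷ u) zero    _         = refl
  get-∷ʳ-< (y ∷ u) (suc r) (s≤s r<m) = get-∷ʳ-< u r r<m
  get-∷ʳ-last : ∀ {m} (u : Vec Bool m) → get (u ∷ʳ x) m ≡ x
  get-∷ʳ-last []      = refl
  get-∷ʳ-last (y ∷ u) = get-∷ʳ-last u
  get-rot : ∀ r → r < suc n → get (v ∷ʳ x) r ≡ at (x ∷ v) (suc r)
  get-rot r (s≤s r≤n) with m≤n⇒m<n∨m≡n r≤n
  ... | inj₁ r<n  = trans (get-∷ʳ-< v r r<n) (sym (at-< (x ∷ v) (s≤s r<n)))
  ... | inj₂ refl = trans (get-∷ʳ-last v) (at-≡mod (x ∷ v) 0 (suc n) (sym (n%n≡0 (suc n))))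

at-rotN : ∀ {n} p (v : Vec Bool (suc n)) i → at (rotN p v) i ≡ at v (p + i)
at-rotN zero    v i = refl
at-rotN (suc p) v i = trans (at-rotN p (rot v) i) (at-rot v (p + i))

∧-intro : ∀ {a b} → a ≡ true → b ≡ true → a ∧ b ≡ true
∧-intro refl refl = refl

∧-elim : ∀ a {b} → a ∧ b ≡ true → a ≡ true × b ≡ true
∧-elim true b≡true = refl , b≡true

∨-introˡ : ∀ {a} b → a ≡ true → a ∨ b ≡ true
∨-introˡ b refl = refl

∨-elim : ∀ a {b} → a ∨ b ≡ true → a ≡ true ⊎ b ≡ true
∨-elim true  _   = inj₁ refl
∨-elim false b≡t = inj₂ b≡t

true≢false : true ≢ false
true≢false ()

allBelow : ℕ → (ℕ → Bool) → Bool
allBelow zero    f = true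
allBelow (suc t) f = f 0 ∧ allBelow t (f ∘ suc)

allBelow⇒ : ∀ t f → allBelow t f ≡ true → ∀ j → j < t → f j ≡ true
allBelow⇒ (suc t) f all zero    _         = proj₁ (∧-elim (f 0) all)
allBelow⇒ (suc t) f all (suc j) (s≤s j<t) = allBelow⇒ t (f ∘ suc) (proj₂ (∧-elim (f 0) all)) j j<t

allBelow⇐ : ∀ t f → (∀ j → j < t → f j ≡ true) → allBelow t f ≡ true
allBelow⇐ zero    f _   = refl
allBelow⇐ (suc t) f all = ∧-intro (all 0 (s≤s z≤n)) (allBelow⇐ t (f ∘ suc) (λ j j<t → all (suc j) (s≤s j<t)))

anyBelow : ℕ → (ℕ → Bool) → Bool
anyBelow zero    f = false
anyBelow (suc t) f = f t ∨ anyBelow t f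

anyBelow⇒ : ∀ t f → anyBelow t f ≡ true → ∃ λ p → p < t × f p ≡ true
anyBelow⇒ (suc t) f any with ∨-elim (f t) any
... | inj₁ ft  = t , ≤-refl , ft
... | inj₂ any′ with anyBelow⇒ t f any′
...   | p , p<t , fp = p , m≤n⇒m≤1+n p<t , fp

anyBelow⇐ : ∀ t f p → p < t → f p ≡ true → anyBelow t f ≡ true
anyBelow⇐ (suc t) f p (s≤s p≤t) fp with m≤n⇒m<n∨m≡n p≤t
... | inj₂ refl = ∨-introˡ _ fp
... | inj₁ p<t  rewrite anyBelow⇐ t f p p<t fp = ∨-zeroʳ (f t)

least-true : ∀ (f : ℕ → Bool) k → f k ≡ true →
  ∃ λ j → j ≤ k × f j ≡ true × (∀ i → i < j → f i ≡ false)
least-true f zero    fk = 0 , z≤n , fk , λ _ ()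
least-true f (suc k) fk with f 0 in f0
... | true  = 0 , z≤n , f0 , λ _ ()
... | false with least-true (f ∘ suc) k fk
...   | j , j≤k , fj , below = suc j , s≤s j≤k , fj , λ { zero _ → f0 ; (suc i) (s≤s i<j) → below i i<j }

leads : ∀ {n} → ℕ → Vec Bool n → Bool
leads th u = get u 0 ∧ allBelow th (λ j → not (get u (suc j)))

runAt : ∀ {n} → ℕ → ℕ → Vec Bool n → Bool
runAt th p v = leads th (rotN p v)

Run : ∀ {n} → ℕ → ℕ → Vec Bool n → Set
Run th p v = at v p ≡ true × (∀ j → j < th → at v (p + suc j) ≡ false)

get-rotN : ∀ {n} p (v : Vec Bool (suc n)) j → j < suc n → get (rotN p v) j ≡ at v (p + j)
get-rotN p v j j<n = trans (sym (at-< (rotN p v) j<n)) (at-rotN p v j)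

runAt⇒Run : ∀ {n} th p (v : Vec Bool (suc n)) → th < suc n → runAt th p v ≡ true → Run th p v
runAt⇒Run th p v th<n run =
  trans (sym (trans (get-rotN p v 0 (s≤s z≤n)) (cong (at v) (+-identityʳ p)))) (proj₁ lead) ,
  λ j j<th → trans (sym (get-rotN p v (suc j) (≤-<-trans j<th th<n)))
                   (not-true (allBelow⇒ th _ (proj₂ lead) j j<th))
  where
  lead = ∧-elim (get (rotN p v) 0) run
  not-true : ∀ {b} → not b ≡ true → b ≡ false
  not-true {false} _ = refl

Run⇒runAt : ∀ {n} th p (v : Vec Bool (suc n)) → th < suc n → Run th p v → runAt th p v ≡ true
Run⇒runAt th p v th<n (one , zeros) =
  ∧-intro (trans (get-rotN p v 0 (s≤s z≤n)) (trans (cong (at v) (+-identityʳ p)) one))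
          (allBelow⇐ th _ (λ j j<th → cong not (trans (get-rotN p v (suc j) (≤-<-trans j<th th<n)) (zeros j j<th))))

-- isBad th v: v is zero, or some cyclic 1 is followed by th 0's; for
-- th = badThreshold n this decides badness (Bad⇒isBad, isBad⇒Bad).
isBad : ∀ {n} → ℕ → Vec Bool n → Bool
isBad {n} th v = hasOnes 0 v ∨ anyBelow n (λ p → runAt th p v)

ones≡0⇒replicate : ∀ {n} (v : Vec Bool n) → ones v ≡ 0 → v ≡ replicate n false
ones≡0⇒replicate []          _ = refl
ones≡0⇒replicate (false ∷ v) z = cong (false ∷_) (ones≡0⇒replicate v z)

ones-replicate : ∀ n → ones (replicate n false) ≡ 0
ones-replicate zero    = refl
ones-replicate (suc n) = ones-replicate n

-- A bad block of length l ≥ th starting at i is a run of th 0's after the 1 at i - 1.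
Bad⇒isBad : ∀ {n} (v : Vec Bool (suc n)) → badThreshold (suc n) < suc n →
  Bad v → isBad (badThreshold (suc n)) v ≡ true
Bad⇒isBad {n} v th<n (inj₁ refl) =
  ∨-introˡ _ (hasOnes⇐ 0 (replicate (suc n) false) (ones-replicate (suc n)))
Bad⇒isBad {n} v th<n (inj₂ (i , l , block , th≤l)) with hasOnes 0 v
... | true  = refl
... | false = anyBelow⇐ (suc n) _ p (m%n<n (i + n) (suc n)) (Run⇒runAt th p v th<n (one , zeros))
  where
  th = badThreshold (suc n)
  p  = (i + n) % suc n
  one : at v p ≡ true
  one = trans (at-≡mod v p (i + n) (m%n%n≡m%n (i + n) (suc n))) (Block.leftEnd block)
  shift : ∀ j → i + n + suc j ≡ i + j + suc n
  shift j = begin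
    i + n + suc j   ≡⟨ +-assoc i n (suc j) ⟩
    i + (n + suc j) ≡⟨ cong (i +_) (trans (+-suc n j) (cong suc (+-comm n j))) ⟩
    i + suc (j + n) ≡⟨ cong (i +_) (+-suc j n) ⟨
    i + (j + suc n) ≡⟨ +-assoc i j (suc n) ⟨
    i + j + suc n   ∎
  zeros : ∀ j → j < th → at v (p + suc j) ≡ false
  zeros j j<th = begin
    at v (p + suc j)       ≡⟨ at-% v (i + n) (suc j) ⟩
    at v (i + n + suc j)   ≡⟨ cong (at v) (shift j) ⟩
    at v (i + j + suc n)   ≡⟨ at-+n v (i + j) ⟩
    at v (i + j)           ≡⟨ Block.zeros block j (<-≤-trans j<th th≤l) ⟩
    false                  ∎

-- Conversely a run of th 0's after a 1 extends to a maximal block of length ≥ th.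
isBad⇒Bad : ∀ {n} (v : Vec Bool (suc n)) → 1 ≤ badThreshold (suc n) → badThreshold (suc n) < suc n →
  isBad (badThreshold (suc n)) v ≡ true → Bad v
isBad⇒Bad {n} v 1≤th th<n bad with hasOnes 0 v in zero?
... | true  = inj₁ (ones≡0⇒replicate v (hasOnes⇒ 0 v zero?))
... | false with anyBelow⇒ (suc n) _ bad
...   | p , _ , run with runAt⇒Run (badThreshold (suc n)) p v th<n run
...     | one , zeros with least-true (λ j → at v (p + suc j)) n (trans (at-+n v p) one)
...       | l , l≤n , end , below = inj₂ (i , l , block , th≤l)
  where
  th = badThreshold (suc n)
  i  = (p + 1) % suc n
  from-i : ∀ j → at v (i + j) ≡ at v (p + suc j)
  from-i j = trans (at-% v (p + 1) j) (cong (at v) (+-assoc p 1 j))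
  th≤l : th ≤ l
  th≤l with l <? th
  ... | no  l≮th = ≮⇒≥ l≮th
  ... | yes l<th = ⊥-elim (true≢false (trans (sym end) (zeros l l<th)))
  block : Block v i l
  block = record
    { start<n  = m%n<n (p + 1) (suc n)
    ; 1≤l      = ≤-trans 1≤th th≤l
    ; l<n      = s≤s l≤n
    ; zeros    = λ j j<l → trans (from-i j) (below j j<l)
    ; rightEnd = trans (from-i l) end
    ; leftEnd  = trans (from-i n) (trans (at-+n v p) one)
    }

good⇔ : ∀ {n} th (v : Vec Bool (suc n)) → badThreshold (suc n) ≡ th → 1 ≤ th → th < suc n →
  Good v ⇔ (not (isBad th v) ≡ true)
good⇔ th v refl 1≤th th<n = mk⇔ to from
  where
  to : Good v → not (isBad th v) ≡ true
  to good with isBad th v in bad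
  ... | true  = ⊥-elim (good (isBad⇒Bad v 1≤th th<n bad))
  ... | false = refl
  from : not (isBad th v) ≡ true → Good v
  from ok bad = true≢false (sym (trans (cong not (sym (Bad⇒isBad v th<n bad))) ok))

goodWith⇔ : ∀ {n} th m (v : Vec Bool (suc n)) → badThreshold (suc n) ≡ th → 1 ≤ th → th < suc n →
  GoodWith m v ⇔ ((not (isBad th v) ∧ hasOnes m v) ≡ true)
goodWith⇔ th m v threshold 1≤th th<n = mk⇔
  (λ (good , ones≡m) → ∧-intro (Equivalence.to good⇔′ good) (hasOnes⇐ m v ones≡m))
  (λ ok → let good , ones≡m = ∧-elim (not (isBad th v)) ok
          in Equivalence.from good⇔′ good , hasOnes⇒ m v ones≡m)
  where good⇔′ = good⇔ th v threshold 1≤th th<n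

run-gap : ∀ {n} th p d (v : Vec Bool (suc n)) → Run th p v → at v (p + d) ≡ true → 1 ≤ d → th < d
run-gap th p (suc j) v (_ , zeros) one _ with th ≤? j
... | yes th≤j = s≤s th≤j
... | no  th≰j = ⊥-elim (true≢false (trans (sym one) (zeros j (≰⇒> th≰j))))

runs-separated : ∀ {n} th p q (v : Vec Bool (suc n)) → p < q → q < suc n →
  Run th p v → Run th q v → th < q ∸ p × suc th + (q ∸ p) ≤ suc n
runs-separated {n} th p q v p<q q<n run-p run-q = gap-pq , gap-qp
  where
  d = q ∸ p
  e = suc n ∸ d
  p+d≡q : p + d ≡ q
  p+d≡q = m+[n∸m]≡n (<⇒≤ p<q)
  d<n : d < suc n
  d<n = ≤-<-trans (m∸n≤m q p) q<n
  gap-pq : th < d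
  gap-pq = run-gap th p d v run-p (trans (cong (at v) p+d≡q) (proj₁ run-q)) (m<n⇒0<n∸m p<q)
  q+e≡p+n : q + e ≡ p + suc n
  q+e≡p+n = begin
    q + e       ≡⟨ cong (_+ e) p+d≡q ⟨
    p + d + e   ≡⟨ +-assoc p d e ⟩
    p + (d + e) ≡⟨ cong (p +_) (m+[n∸m]≡n (<⇒≤ d<n)) ⟩
    p + suc n   ∎
  gap-qp : suc th + d ≤ suc n
  gap-qp = ≤-trans (+-monoˡ-≤ d gap-qp′) (≤-reflexive (m∸n+n≡m (<⇒≤ d<n)))
    where
    gap-qp′ : th < e
    gap-qp′ = run-gap th q e v run-q (trans (cong (at v) q+e≡p+n) (trans (at-+n v p) (proj₁ run-p)))
                      (m<n⇒0<n∸m d<n)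

sumBelow : ℕ → (ℕ → ℕ) → ℕ
sumBelow zero    f = 0
sumBelow (suc J) f = f J + sumBelow J f

sumBelow-const : ∀ J {f} c → (∀ j → j < J → f j ≡ c) → sumBelow J f ≡ J * c
sumBelow-const zero    c _     = refl
sumBelow-const (suc J) c f≡c =
  cong₂ _+_ (f≡c J ≤-refl) (sumBelow-const J c (λ j j<J → f≡c j (m≤n⇒m≤1+n j<J)))

sumBelow-step : ∀ J k c {f} → (∀ j → j < J → j < k → f j ≡ 0) → (∀ j → j < J → k ≤ j → f j ≡ c) →
  sumBelow J f ≡ (J ∸ k) * c
sumBelow-step zero k c _ _ = cong (_* c) (sym (0∸n≡0 k))
sumBelow-step (suc J) k c {f} early late = begin
  f J + sumBelow J f
    ≡⟨ cong (f J +_) (sumBelow-step J k c (λ j → early j ∘ m≤n⇒m≤1+n) (λ j → late j ∘ m≤n⇒m≤1+n)) ⟩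
  f J + (J ∸ k) * c   ≡⟨ add-last ⟩
  (suc J ∸ k) * c     ∎
  where
  add-last : f J + (J ∸ k) * c ≡ (suc J ∸ k) * c
  add-last with J <? k
  ... | yes J<k = trans (cong (_+ (J ∸ k) * c) (early J ≤-refl J<k))
                        (cong (_* c) (trans (m≤n⇒m∸n≡0 (<⇒≤ J<k)) (sym (m≤n⇒m∸n≡0 J<k))))
  ... | no  J≮k = trans (cong (_+ (J ∸ k) * c) (late J ≤-refl (≮⇒≥ J≮k)))
                        (cong (_* c) (sym (+-∸-assoc 1 (≮⇒≥ J≮k))))

-- Counting a union of events E 0, …, E (J-1) by adding them one at a time:
-- each event contributes its size minus its overlap with the earlier ones.
count-union : ∀ n (E : ℕ → Vec Bool n → Bool) (Q : Vec Bool n → Bool) J →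
  count n (λ v → anyBelow J (λ p → E p v) ∧ Q v)
    + sumBelow J (λ j → count n (λ v → (E j v ∧ anyBelow j (λ p → E p v)) ∧ Q v))
  ≡ sumBelow J (λ j → count n (λ v → E j v ∧ Q v))
count-union n E Q zero = trans (+-identityʳ _) (count-none n (λ _ → refl))
count-union n E Q (suc J) = begin
  U (suc J) + (X J + ΣX)   ≡⟨ +-assoc (U (suc J)) (X J) ΣX ⟨
  (U (suc J) + X J) + ΣX   ≡⟨ cong (_+ ΣX) (count-∨∧ n (E J) (λ v → anyBelow J (λ p → E p v)) Q) ⟩
  (C J + U J) + ΣX         ≡⟨ +-assoc (C J) (U J) ΣX ⟩
  C J + (U J + ΣX)         ≡⟨ cong (C J +_) (count-union n E Q J) ⟩
  C J + sumBelow J C       ∎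
  where
  U X C : ℕ → ℕ
  U j = count n (λ v → anyBelow j (λ p → E p v) ∧ Q v)
  X j = count n (λ v → (E j v ∧ anyBelow j (λ p → E p v)) ∧ Q v)
  C j = count n (λ v → E j v ∧ Q v)
  ΣX = sumBelow J X

runPrefix : ∀ th {k} → Vec Bool k → Vec Bool (suc (th + k))
runPrefix th w = true ∷ (replicate th false ++ w)

count-zeros : ∀ t r (R : Vec Bool (t + r) → Bool) →
  count (t + r) (λ v → allBelow t (λ j → not (get v j)) ∧ R v) ≡ count r (λ w → R (replicate t false ++ w))
count-zeros zero    r R = refl
count-zeros (suc t) r R = cong₂ _+_ (count-none (t + r) (λ _ → refl)) (count-zeros t r (λ v → R (false ∷ v)))

count-zeros-all : ∀ t (R : Vec Bool t → Bool) →
  count t (λ v → allBelow t (λ j → not (get v j)) ∧ R v) ≡ (if R (replicate t false) then 1 else 0)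
count-zeros-all zero    R = refl
count-zeros-all (suc t) R = cong₂ _+_ (count-none t (λ _ → refl)) (count-zeros-all t (λ v → R (false ∷ v)))

count-leads : ∀ th k (R : Vec Bool (suc (th + k)) → Bool) →
  count (suc (th + k)) (λ v → leads th v ∧ R v) ≡ count k (R ∘ runPrefix th)
count-leads th k R =
  trans (cong₂ _+_ (count-zeros th k (λ v → R (true ∷ v))) (count-none (th + k) (λ _ → refl))) (+-identityʳ _)

count-leads-all : ∀ t (R : Vec Bool (suc t) → Bool) →
  count (suc t) (λ v → leads t v ∧ R v) ≡ (if R (true ∷ replicate t false) then 1 else 0)
count-leads-all t R =
  trans (cong₂ _+_ (count-zeros-all t (λ v → R (true ∷ v))) (count-none t (λ _ → refl))) (+-identityʳ _)

RotationInvariant : ∀ {n} → (Vec Bool n → Bool) → Set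
RotationInvariant {n} Q = ∀ p (v : Vec Bool n) → Q (rotN p v) ≡ Q v

hasOnes-invariant : ∀ {n} m → RotationInvariant {n} (hasOnes m)
hasOnes-invariant m p v = cong (_≡ᵇ m) (ones-rotN p v)

-- A run at a fixed position p: rotating it to position 0 shows that there
-- are as many such tuples in Q as tuples w ∈ {0,1}ᵏ with Q (1 0^th w).
count-runAt : ∀ th k p (Q : Vec Bool (suc (th + k)) → Bool) → RotationInvariant Q →
  count (suc (th + k)) (λ v → runAt th p v ∧ Q v) ≡ count k (Q ∘ runPrefix th)
count-runAt th k p Q invariant = begin
  count N (λ v → runAt th p v ∧ Q v)            ≡⟨ count-ext N (λ v → cong (runAt th p v ∧_) (invariant p v)) ⟨
  count N (λ v → leads th (rotN p v) ∧ Q (rotN p v)) ≡⟨ count-rotN N p (λ u → leads th u ∧ Q u) ⟩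
  count N (λ u → leads th u ∧ Q u)              ≡⟨ count-leads th k Q ⟩
  count k (Q ∘ runPrefix th)                    ∎
  where N = suc (th + k)

ones≡0⇒get : ∀ {n} (v : Vec Bool n) → ones v ≡ 0 → ∀ i → get v i ≡ false
ones≡0⇒get []          _ _       = refl
ones≡0⇒get (false ∷ v) _ zero    = refl
ones≡0⇒get (false ∷ v) z (suc i) = ones≡0⇒get v z i

-- The zero tuple contains no run, so isBad is a disjoint union of
-- "zero" and "some run".
count-isBad : ∀ n th (Q : Vec Bool (suc n) → Bool) → th < suc n →
  count (suc n) (λ v → isBad th v ∧ Q v)
    ≡ count (suc n) (λ v → hasOnes 0 v ∧ Q v) + count (suc n) (λ v → anyBelow (suc n) (λ p → runAt th p v) ∧ Q v)
count-isBad n th Q th<n = begin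
  count N (λ v → isBad th v ∧ Q v)                   ≡⟨ +-identityʳ _ ⟨
  count N (λ v → isBad th v ∧ Q v) + 0
    ≡⟨ cong (count N (λ v → isBad th v ∧ Q v) +_) (count-none N disjoint) ⟨
  count N (λ v → isBad th v ∧ Q v) + count N (λ v → (hasOnes 0 v ∧ anyRun v) ∧ Q v)
                                                     ≡⟨ count-∨∧ N (hasOnes 0) anyRun Q ⟩
  count N (λ v → hasOnes 0 v ∧ Q v) + count N (λ v → anyRun v ∧ Q v) ∎
  where
  N = suc n
  anyRun : Vec Bool N → Bool
  anyRun v = anyBelow N (λ p → runAt th p v)
  disjoint : ∀ v → (hasOnes 0 v ∧ anyRun v) ∧ Q v ≡ false
  disjoint v = ¬-not λ both → let zero? , run = ∧-elim (hasOnes 0 v) (proj₁ (∧-elim (hasOnes 0 v ∧ anyRun v) both))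
                               in no-run zero? run
    where
    no-run : hasOnes 0 v ≡ true → anyRun v ≡ true → ⊥
    no-run zero? run with anyBelow⇒ N _ run
    ... | p , _ , run-p = true≢false (trans (sym (proj₁ (runAt⇒Run th p v th<n run-p)))
                                          (trans (at-get v p) (ones≡0⇒get v (hasOnes⇒ 0 v zero?) _)))

overlapAt : ∀ {n} → ℕ → ℕ → Vec Bool n → Bool
overlapAt th j v = runAt th j v ∧ anyBelow j (λ p → runAt th p v)

overlaps : ∀ th k → (Vec Bool (suc (th + k)) → Bool) → ℕ
overlaps th k Q = sumBelow (suc (th + k)) (λ j → count (suc (th + k)) (λ v → overlapAt th j v ∧ Q v))

count-bad : ∀ th k (Q : Vec Bool (suc (th + k)) → Bool) → RotationInvariant Q →
  count (suc (th + k)) (λ v → isBad th v ∧ Q v) + overlaps th k Q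
    ≡ count (suc (th + k)) (λ v → hasOnes 0 v ∧ Q v) + suc (th + k) * count k (Q ∘ runPrefix th)
count-bad th k Q invariant = begin
  count N (λ v → isBad th v ∧ Q v) + overlaps th k Q ≡⟨ cong (_+ overlaps th k Q) (count-isBad (th + k) th Q th<N) ⟩
  (Z + U) + overlaps th k Q                          ≡⟨ +-assoc Z U (overlaps th k Q) ⟩
  Z + (U + overlaps th k Q)                          ≡⟨ cong (Z +_) (count-union N (runAt th) Q N) ⟩
  Z + sumBelow N (λ j → count N (λ v → runAt th j v ∧ Q v))
    ≡⟨ cong (Z +_) (sumBelow-const N _ (λ j _ → count-runAt th k j Q invariant)) ⟩
  Z + N * count k (Q ∘ runPrefix th)                 ∎
  where
  N = suc (th + k)
  th<N = s≤s (m≤m+n th k)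
  Z = count N (λ v → hasOnes 0 v ∧ Q v)
  U = count N (λ v → anyBelow N (λ p → runAt th p v) ∧ Q v)

overlap-none : ∀ {n} th j (Q : Vec Bool (suc n) → Bool) → th < suc n →
  (∀ v p → p < j → Run th p v → Run th j v → ⊥) → count (suc n) (λ v → overlapAt th j v ∧ Q v) ≡ 0
overlap-none {n} th j Q th<n apart = count-none (suc n) {λ v → overlapAt th j v ∧ Q v} λ v → ¬-not λ both →
  let run-j , earlier = ∧-elim (runAt th j v) (proj₁ (∧-elim (overlapAt th j v) both))
      p , p<j , run-p  = anyBelow⇒ j _ earlier
  in apart v p p<j (runAt⇒Run th p v th<n run-p) (runAt⇒Run th j v th<n run-j)

-- n = 2k + 1, th = k: two runs would need 2(k + 1) > n positions, so runs
-- never coexist and all overlaps vanish.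
odd-overlaps : ∀ k (Q : Vec Bool (suc (k + k)) → Bool) → overlaps k k Q ≡ 0
odd-overlaps k Q = trans (sumBelow-const N 0 (λ j j<N → overlap-none k j Q (s≤s (m≤m+n k k)) (apart j j<N))) (*-zeroʳ N)
  where
  N = suc (k + k)
  apart : ∀ j → j < N → ∀ v p → p < j → Run k p v → Run k j v → ⊥
  apart j j<N v p p<j run-p run-j with runs-separated k p j v p<j j<N run-p run-j
  ... | k<d , fits = n≮n k (+-cancelˡ-≤ (suc k) (suc k) k (≤-trans (+-monoʳ-≤ (suc k) k<d) fits))

-- n = 2(t + 1), th = t: runs are t + 1 apart, so a run at j ≤ t has no earlier run …
even-overlap-early : ∀ t j (Q : Vec Bool (suc t + suc t) → Bool) → j < suc t →
  count (suc t + suc t) (λ v → overlapAt t j v ∧ Q v) ≡ 0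
even-overlap-early t j Q j<k = overlap-none t j Q (s≤s (m≤m+n t (suc t))) apart
  where
  apart : ∀ v p → p < j → Run t p v → Run t j v → ⊥
  apart v p p<j run-p run-j =
    <⇒≱ (≤-<-trans (m∸n≤m j p) j<k)
        (proj₁ (runs-separated t p j v p<j (≤-trans j<k (m≤n+m (suc t) (suc t))) run-p run-j))

bool-≡ : ∀ {a b} → (a ≡ true → b ≡ true) → (b ≡ true → a ≡ true) → a ≡ b
bool-≡ {true}  {true}  _    _    = refl
bool-≡ {true}  {false} a⇒b _    = sym (a⇒b refl)
bool-≡ {false} {true}  _    b⇒a = b⇒a refl
bool-≡ {false} {false} _    _    = refl

∧-congˡ-true : ∀ a {b c} → (a ≡ true → b ≡ c) → a ∧ b ≡ a ∧ c
∧-congˡ-true true  b≡c = b≡c refl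
∧-congˡ-true false _   = refl

-- … and a run at j = a + t + 1 meets exactly one earlier run, the one at a,
-- so rotating by a reduces the overlap to runs at 0 and t + 1.
even-overlap-late : ∀ t a (Q : Vec Bool (suc t + suc t) → Bool) → RotationInvariant Q → a + suc t < suc t + suc t →
  count (suc t + suc t) (λ v → overlapAt t (a + suc t) v ∧ Q v)
    ≡ count (suc t + suc t) (λ u → (runAt t (suc t) u ∧ leads t u) ∧ Q u)
even-overlap-late t a Q invariant j<N =
  trans (count-ext N rotate-by-a) (count-rotN N a (λ u → (runAt t (suc t) u ∧ leads t u) ∧ Q u))
  where
  N = suc t + suc t
  j = a + suc t
  th<N = s≤s (m≤m+n t (suc t))
  only-a : ∀ v → runAt t j v ≡ true → anyBelow j (λ p → runAt t p v) ≡ runAt t a v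
  only-a v run-j = bool-≡ earlier⇒a (anyBelow⇐ j _ a (m<m+n a (s≤s z≤n)))
    where
    earlier⇒a : anyBelow j (λ p → runAt t p v) ≡ true → runAt t a v ≡ true
    earlier⇒a earlier with anyBelow⇒ j _ earlier
    ... | p , p<j , run-p with runs-separated t p j v p<j j<N (runAt⇒Run t p v th<N run-p) (runAt⇒Run t j v th<N run-j)
    ...   | t<d , fits = subst (λ q → runAt t q v ≡ true) p≡a run-p
      where
      d≡k : j ∸ p ≡ suc t
      d≡k = ≤-antisym (+-cancelˡ-≤ (suc t) (j ∸ p) (suc t) fits) t<d
      p≡a : p ≡ a
      p≡a = +-cancelʳ-≡ (suc t) p a (trans (cong (p +_) (sym d≡k)) (m+[n∸m]≡n (<⇒≤ p<j)))
  rotate-by-a : ∀ v → overlapAt t j v ∧ Q v ≡ (runAt t (suc t) (rotN a v) ∧ leads t (rotN a v)) ∧ Q (rotN a v)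
  rotate-by-a v rewrite invariant a v | rotN-+ a (suc t) v = cong (_∧ Q v) (∧-congˡ-true (runAt t j v) (only-a v))

allBelow-cong : ∀ t {f g} → (∀ j → j < t → f j ≡ g j) → allBelow t f ≡ allBelow t g
allBelow-cong zero    _   = refl
allBelow-cong (suc t) f≗g = cong₂ _∧_ (f≗g 0 (s≤s z≤n)) (allBelow-cong t (λ j j<t → f≗g (suc j) (s≤s j<t)))

runAt-get : ∀ {n} th p (u : Vec Bool (suc n)) → p + th < suc n →
  runAt th p u ≡ get u p ∧ allBelow th (λ j → not (get u (p + suc j)))
runAt-get th p u p+th<n = cong₂ _∧_
  (trans (get-rotN p u 0 (s≤s z≤n)) (trans (cong (at u) (+-identityʳ p)) (at-< u (≤-<-trans (m≤m+n p th) p+th<n))))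
  (allBelow-cong th λ j j<th → cong not
    (trans (get-rotN p u (suc j) (≤-<-trans (≤-trans j<th (m≤n+m th p)) p+th<n))
           (at-< u (≤-<-trans (+-monoʳ-≤ p j<th) p+th<n))))

get-zeros++ : ∀ t {r} (w : Vec Bool r) i → get (replicate t false ++ w) (t + i) ≡ get w i
get-zeros++ zero    w i = refl
get-zeros++ (suc t) w i = get-zeros++ t w i

runAt-runPrefix : ∀ t (w : Vec Bool (suc t)) → runAt t (suc t) (runPrefix t w) ≡ leads t w
runAt-runPrefix t w = trans (runAt-get t (suc t) (runPrefix t w) (s≤s (≤-reflexive (+-comm (suc t) t))))
  (cong₂ _∧_ (trans (cong (get (replicate t false ++ w)) (sym (+-identityʳ t))) (get-zeros++ t w 0))
             (allBelow-cong t (λ j _ → cong not (get-zeros++ t w (suc j)))))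

-- doubleRun t = 1 0^t 1 0^t, the only tuple with runs at both 0 and t + 1.
doubleRun : ∀ t → Vec Bool (suc t + suc t)
doubleRun t = runPrefix t (true ∷ replicate t false)

count-doubleRun : ∀ t (Q : Vec Bool (suc t + suc t) → Bool) →
  count (suc t + suc t) (λ u → (runAt t (suc t) u ∧ leads t u) ∧ Q u) ≡ (if Q (doubleRun t) then 1 else 0)
count-doubleRun t Q = begin
  count N (λ u → (runAt t (suc t) u ∧ leads t u) ∧ Q u)
    ≡⟨ count-ext N (λ u → trans (cong (_∧ Q u) (∧-comm (runAt t (suc t) u) (leads t u)))
                                 (∧-assoc (leads t u) (runAt t (suc t) u) (Q u))) ⟩
  count N (λ u → leads t u ∧ (runAt t (suc t) u ∧ Q u))
    ≡⟨ count-leads t (suc t) (λ u → runAt t (suc t) u ∧ Q u) ⟩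
  count (suc t) (λ w → runAt t (suc t) (runPrefix t w) ∧ Q (runPrefix t w))
    ≡⟨ count-ext (suc t) (λ w → cong (_∧ Q (runPrefix t w)) (runAt-runPrefix t w)) ⟩
  count (suc t) (λ w → leads t w ∧ Q (runPrefix t w))
    ≡⟨ count-leads-all t (Q ∘ runPrefix t) ⟩
  (if Q (doubleRun t) then 1 else 0) ∎
  where N = suc t + suc t

-- n = 2(t + 1): the overlaps at j = t + 1, …, n - 1 each count doubleRun once (if in Q).
even-overlaps : ∀ t (Q : Vec Bool (suc t + suc t) → Bool) → RotationInvariant Q →
  overlaps t (suc t) Q ≡ suc t * (if Q (doubleRun t) then 1 else 0)
even-overlaps t Q invariant =
  trans (sumBelow-step N (suc t) c (λ j _ j<k → even-overlap-early t j Q j<k) late)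
        (cong (_* c) (m+n∸m≡n (suc t) (suc t)))
  where
  N = suc t + suc t
  c = if Q (doubleRun t) then 1 else 0
  late : ∀ j → j < N → suc t ≤ j → count N (λ v → overlapAt t j v ∧ Q v) ≡ c
  late j j<N k≤j = subst (λ i → count N (λ v → overlapAt t i v ∧ Q v) ≡ c) (m∸n+n≡m k≤j)
    (trans (even-overlap-late t (j ∸ suc t) Q invariant (subst (_< N) (sym (m∸n+n≡m k≤j)) j<N))
           (count-doubleRun t Q))

-- Part (i) for n = th + 1 + k, given the total overlap c of the runs:
-- |Good| + |Bad| = 2ⁿ with |Bad| + c = 1 + n·2ᵏ.
good-count : ∀ th k c → overlaps th k (λ _ → true) ≡ c →
  count (suc (th + k)) (λ v → not (isBad th v)) + 1 + suc (th + k) * 2 ^ k ≡ 2 ^ suc (th + k) + c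
good-count th k c overlaps≡c = begin
  G + 1 + N * 2 ^ k    ≡⟨ +-assoc G 1 (N * 2 ^ k) ⟩
  G + (1 + N * 2 ^ k)  ≡⟨ cong (G +_) bad+c ⟨
  G + (B + c)          ≡⟨ +-assoc G B c ⟨
  G + B + c            ≡⟨ cong (_+ c) good+bad ⟩
  2 ^ N + c            ∎
  where
  N = suc (th + k)
  G = count N (λ v → not (isBad th v))
  B = count N (isBad th)
  ∧true : ∀ (P : Vec Bool N → Bool) → count N (λ v → P v ∧ true) ≡ count N P
  ∧true P = count-ext N (λ v → ∧-identityʳ (P v))
  good+bad : G + B ≡ 2 ^ N
  good+bad = begin
    G + B ≡⟨ cong₂ _+_ (∧true (λ v → not (isBad th v))) (∧true (isBad th)) ⟨
    count N (λ v → not (isBad th v) ∧ true) + count N (λ v → isBad th v ∧ true)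
          ≡⟨ count-complement N (isBad th) (λ _ → true) ⟩
    count N (λ _ → true) ≡⟨ count-all N ⟩
    2 ^ N ∎
  bad+c : B + c ≡ 1 + N * 2 ^ k
  bad+c = begin
    B + c                                         ≡⟨ cong₂ _+_ (∧true (isBad th)) overlaps≡c ⟨
    count N (λ v → isBad th v ∧ true) + overlaps th k (λ _ → true)
                                                  ≡⟨ count-bad th k (λ _ → true) (λ _ _ → refl) ⟩
    count N (λ v → hasOnes 0 v ∧ true) + N * count k (λ _ → true)
      ≡⟨ cong₂ (λ z a → z + N * a) (trans (∧true (hasOnes 0)) (count-hasOnes N 0)) (count-all k) ⟩
    1 + N * 2 ^ k                                 ∎

ones-zeros++ : ∀ t {r} (w : Vec Bool r) → ones (replicate t false ++ w) ≡ ones w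
ones-zeros++ zero    w = refl
ones-zeros++ (suc t) w = ones-zeros++ t w

goodWith-count : ∀ th k m → overlaps th k (hasOnes (suc m)) ≡ 0 →
  count (suc (th + k)) (λ v → not (isBad th v) ∧ hasOnes (suc m) v) + suc (th + k) * (k C m) ≡ suc (th + k) C suc m
goodWith-count th k m no-overlaps = begin
  G + N * (k C m)          ≡⟨ cong (G +_) bad ⟨
  G + B                    ≡⟨ count-complement N (isBad th) (hasOnes (suc m)) ⟩
  count N (hasOnes (suc m)) ≡⟨ count-hasOnes N (suc m) ⟩
  N C suc m                ∎
  where
  N = suc (th + k)
  G = count N (λ v → not (isBad th v) ∧ hasOnes (suc m) v)
  B = count N (λ v → isBad th v ∧ hasOnes (suc m) v)
  not-zero : ∀ x → (x ≡ᵇ 0) ∧ (x ≡ᵇ suc m) ≡ false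
  not-zero zero    = refl
  not-zero (suc _) = refl
  bad : B ≡ N * (k C m)
  bad = begin
    B                                            ≡⟨ +-identityʳ B ⟨
    B + 0                                        ≡⟨ cong (B +_) no-overlaps ⟨
    B + overlaps th k (hasOnes (suc m))          ≡⟨ count-bad th k (hasOnes (suc m)) (hasOnes-invariant (suc m)) ⟩
    count N (λ v → hasOnes 0 v ∧ hasOnes (suc m) v) + N * count k (hasOnes (suc m) ∘ runPrefix th)
      ≡⟨ cong₂ (λ z a → z + N * a) (count-none N (λ v → not-zero (ones v)))
                                   (count-ext k (λ w → cong (_≡ᵇ m) (ones-zeros++ th w))) ⟩
    N * count k (hasOnes m)                      ≡⟨ cong (N *_) (count-hasOnes k m) ⟩
    N * (k C m)                                  ∎

-- doubleRun has only two ones, so among tuples with ≥ 3 ones runs never overlap.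
ones-doubleRun : ∀ t → ones (doubleRun t) ≡ 2
ones-doubleRun t = cong suc (trans (ones-zeros++ t (true ∷ replicate t false)) (cong suc (ones-replicate t)))

even-overlaps-many : ∀ t m → 2 ≤ m → overlaps t (suc t) (hasOnes (suc m)) ≡ 0
even-overlaps-many t (suc zero) (s≤s ())
even-overlaps-many t m@(suc (suc _)) _ = begin
  overlaps t (suc t) (hasOnes (suc m))                           ≡⟨ even-overlaps t _ (hasOnes-invariant (suc m)) ⟩
  suc t * (if hasOnes (suc m) (doubleRun t) then 1 else 0)
    ≡⟨ cong (λ x → suc t * (if x ≡ᵇ suc m then 1 else 0)) (ones-doubleRun t) ⟩
  suc t * 0                                                      ≡⟨ *-zeroʳ (suc t) ⟩
  0                                                              ∎

goodCard : ∀ th k c → 1 ≤ th → badThreshold (suc (th + k)) ≡ th → suc (th + k) / 2 ≡ k →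
  overlaps th k (λ _ → true) ≡ c →
  ∃ λ G → HasCard (Good {suc (th + k)}) G × G + 1 + suc (th + k) * 2 ^ (suc (th + k) / 2) ≡ 2 ^ suc (th + k) + c
goodCard th k c 1≤th threshold half overlaps≡c =
  count N (λ v → not (isBad th v)) ,
  hasCard-count N _ Good (λ v → good⇔ th v threshold 1≤th (s≤s (m≤m+n th k))) ,
  trans (cong (λ h → count N (λ v → not (isBad th v)) + 1 + N * 2 ^ h) half) (good-count th k c overlaps≡c)
  where N = suc (th + k)

goodWithCard : ∀ th k → 1 ≤ th → badThreshold (suc (th + k)) ≡ th → suc (th + k) / 2 ≡ k →
  (∀ m → 2 ≤ m → overlaps th k (hasOnes (suc m)) ≡ 0) →
  ∀ m → 3 ≤ m → m ≤ suc (th + k) →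
  ∃ λ G → HasCard (GoodWith {suc (th + k)} m) G × G + suc (th + k) * ((suc (th + k) / 2) C (m ∸ 1)) ≡ suc (th + k) C m
goodWithCard th k 1≤th threshold half no-overlaps (suc m) (s≤s 2≤m) _ =
  G , hasCard-count N _ (GoodWith (suc m)) (λ v → goodWith⇔ th (suc m) v threshold 1≤th (s≤s (m≤m+n th k))) ,
  trans (cong (λ h → G + N * (h C m)) half) (goodWith-count th k m (no-overlaps m 2≤m))
  where
  N = suc (th + k)
  G = count N (λ v → not (isBad th v) ∧ hasOnes (suc m) v)

k+k≡k*2 : ∀ k → k + k ≡ k * 2
k+k≡k*2 k = trans (cong (k +_) (sym (+-identityʳ k))) (*-comm 2 k)

half-even : ∀ k → (k + k) / 2 ≡ k
half-even k = trans (cong (_/ 2) (k+k≡k*2 k)) (m*n/n≡m k 2)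

mod-even : ∀ k → (k + k) % 2 ≡ 0
mod-even k = trans (cong (_% 2) (k+k≡k*2 k)) (m*n%n≡0 k 2)

half-odd : ∀ k → suc (k + k) / 2 ≡ k
half-odd k = trans (cong (λ x → suc x / 2) (k+k≡k*2 k))
                   (trans (+-distrib-/-∣ʳ 1 {k * 2} {2} (n∣m*n k)) (m*n/n≡m k 2))

mod-odd : ∀ k → suc (k + k) % 2 ≡ 1
mod-odd k = trans (cong (λ x → suc x % 2) (k+k≡k*2 k)) ([m+kn]%n≡m%n 1 k 2)

threshold-odd : ∀ k → badThreshold (suc (k + k)) ≡ k
threshold-odd k = cong₂ (λ r h → if r ≡ᵇ 0 then h ∸ 1 else h) (mod-odd k) (half-odd k)

threshold-even : ∀ t → badThreshold (suc t + suc t) ≡ t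
threshold-even t = cong₂ (λ r h → if r ≡ᵇ 0 then h ∸ 1 else h) (mod-even (suc t)) (half-even (suc t))

data Parity : ℕ → Set where
  even : ∀ k → Parity (k + k)
  odd  : ∀ k → Parity (suc (k + k))

parity : ∀ n → Parity n
parity zero = even 0
parity (suc n) with parity n
... | even k = odd k
... | odd  k = subst Parity (cong suc (+-suc k k)) (even (suc k))

data Shape : ℕ → Set where
  odd  : ∀ k → 1 ≤ k → Shape (suc (k + k))
  even : ∀ t → 1 ≤ t → Shape (suc t + suc t)

shape : ∀ n → 3 ≤ n → Shape n
shape n 3≤n with parity n
shape .(suc (suc k + suc k))         _               | odd (suc k)        = odd (suc k) (s≤s z≤n)
shape .(suc (suc t) + suc (suc t))   _               | even (suc (suc t)) = even (suc t) (s≤s z≤n)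
shape .1                             (s≤s ())        | odd zero
shape .0                             ()              | even zero
shape .2                             (s≤s (s≤s ()))  | even (suc zero)

lemma3p1 : ∀ (n : ℕ) → 3 ≤ n →
    ((n % 2 ≡ 0 → ∃ λ N → HasCard (Good {n}) N × N + 1 + n * 2 ^ (n / 2) ≡ 2 ^ n + n / 2)
    × (n % 2 ≡ 1 → ∃ λ N → HasCard (Good {n}) N × N + 1 + n * 2 ^ (n / 2) ≡ 2 ^ n))
    × (∀ (m : ℕ) → 3 ≤ m → m ≤ n →
    ∃ λ N → HasCard (GoodWith {n} m) N × N + n * ((n / 2) C (m ∸ 1)) ≡ n C m)
lemma3p1 n 3≤n with shape n 3≤n
... | odd k 1≤k =
  ( (λ n-even → ⊥-elim (1+n≢0 (trans (sym (mod-odd k)) n-even)))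
  , (λ _ → let G , card , G≡ = goodCard k k 0 1≤k (threshold-odd k) (half-odd k) (odd-overlaps k (λ _ → true))
           in G , card , trans G≡ (+-identityʳ _)) )
  , goodWithCard k k 1≤k (threshold-odd k) (half-odd k) (λ m _ → odd-overlaps k (hasOnes (suc m)))
... | even t 1≤t =
  ( (λ _ → let G , card , G≡ = goodCard t (suc t) (suc t) 1≤t (threshold-even t) (half-even (suc t)) all-overlaps
           in G , card , trans G≡ (cong (2 ^ (suc t + suc t) +_) (sym (half-even (suc t)))))
  , (λ n-odd → ⊥-elim (0≢1+n (trans (sym (mod-even (suc t))) n-odd))) )
  , goodWithCard t (suc t) 1≤t (threshold-even t) (half-even (suc t)) (even-overlaps-many t)
  where
  all-overlaps : overlaps t (suc t) (λ _ → true) ≡ suc t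
  all-overlaps = trans (even-overlaps t (λ _ → true) (λ _ _ → refl)) (*-identityʳ (suc t))
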